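{- Let $R$ be a commutative $\mathbb{Q}$-algebra with unit. Then, as maps $R\langle\langle\mathcal{X}\rangle\rangle\to R\langle\langle\mathcal{B}\rangle\rangle$, \[\tau\circ\Pi_0\circ\theta_{\mathcal{X}}^{\operatorname{anti}}=\theta_{\mathcal{Y}}\circ\Pi_{\mathcal{Y}}.\]
   Context: Alphabets $\mathcal{X}=\{x_0,x_1\}$, $\mathcal{Y}=\{y_1,y_2,\ldots\}$, $\mathcal{B}=\{b_0,b_1,\ldots\}$; $R\langle\langle A\rangle\rangle$ denotes non-commutative power series over $R$ in the alphabet $A$. $\theta_{\mathcal{X}}^{\operatorname{anti}}$ is the $R$-linear continuous map with $x_{\varepsilon_1}\cdots x_{\varepsilon_n}\mapsto b_{\varepsilon_n}\cdots b_{\varepsilon_1}$; $\theta_{\mathcal{Y}}$ is the $R$-linear continuous algebra map with $y_i\mapsto b_i$ ($i\geq1$). $\Pi_{\mathcal{Y}}:R\langle\langle\mathcal{X}\rangle\rangle\to R\langle\langle\mathcal{Y}\rangle\rangle$ is the $R$-linear continuous map sending words ending in $x_0$ to $0$ and $x_0^{k_1-1}x_1\cdots x_0^{k_d-1}x_1\mapsto y_{k_1}\cdots y_{k_d}$ ($k_i\geq1$). $\Pi_0$ is the $R$-linear projection on $R\langle\langle\mathcal{B}\rangle\rangle$ that is the identity on words not starting with $b_0$ and sends words starting with $b_0$ to $0$. $\tau$ is the $R$-linear (coefficientwise) map on power series supported on words not starting with $b_0$ given on words by $\tau(b_{k_1}b_0^{m_1}\cdots b_{k_d}b_0^{m_d})=b_{m_d+1}b_0^{k_d-1}\cdots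 b_{m_1+1}b_0^{k_1-1}$ ($k_i\geq1,m_i\geq0$). -}

module Defs where

open import Level using (Level; _⊔_)
open import Data.Nat using (ℕ; zero; suc)
open import Data.Nat.Properties using (_≟_)
open import Data.List using (List; []; _∷_; _++_; [_]; map; reverse; replicate; concat; foldr; filter)
import Data.List.Properties as ListP
import Data.Maybe.Properties as MaybeP
open import Data.Maybe using (Maybe; just; nothing; maybe)
open import Data.Product using (_×_; _,_)
open import Algebra.Bundles using (CommutativeRing)
open import Algebra.Morphism.Structures using (module RingMorphisms)
open import Data.Rational using (ℚ)
import Data.Rational.Properties as ℚP
open import Relation.Binary.PropositionalEquality using (_≡_)

record QAlgebra {c ℓ : Level} (R : CommutativeRing c ℓ) : Set (c ⊔ ℓ) where
  open CommutativeRing R using (Carrier; rawRing)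
  field
    ι     : ℚ → Carrier
    ι-hom : RingMorphisms.IsRingHomomorphism ℚP.+-*-rawRing rawRing ι

data XL : Set where
  x0 x1 : XL

-- Y = {y_1, y_2, ...}; the letter  y i  stands for  y_{i+1}.
data YL : Set where
  y : ℕ → YL

BL : Set
BL = ℕ

-- Decompose a word b_{k1} b0^{m1} ... b_{kd} b0^{md} (k_i ≥ 1) into the
-- blocks (k_i - 1, m_i); returns nothing iff the word starts with b0.
private
  step : ℕ → ℕ × List (ℕ × ℕ) → ℕ × List (ℕ × ℕ)
  step zero    (m , bs) = (suc m , bs)
  step (suc k) (m , bs) = (zero , (k , m) ∷ bs)

  finish : ℕ × List (ℕ × ℕ) → Maybe (List (ℕ × ℕ))
  finish (zero  , bs) = just bs
  finish (suc _ , _)  = nothing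

blocks : List BL → Maybe (List (ℕ × ℕ))
blocks w = finish (foldr step (zero , []) w)

-- τ(b_{k1} b0^{m1} ... b_{kd} b0^{md}) = b_{md+1} b0^{kd-1} ... b_{m1+1} b0^{k1-1};
-- undefined (nothing) on words starting with b0.
τword : List BL → Maybe (List BL)
τword w = maybe (λ bs → just (concat (map blk (reverse bs)))) nothing (blocks w)
  where
  blk : ℕ × ℕ → List BL
  blk (k , m) = suc m ∷ replicate k zero

wt : BL → ℕ
wt zero    = 1
wt (suc k) = suc k

weight : List BL → ℕ
weight = foldr (λ b n → wt b Data.Nat.+ n) zero
  where import Data.Nat

-- wordsOfWeightUpTo n = [W n , W (n-1) , ... , W 0], where W j is the
-- (finite) list of all B-words of weight exactly j.
private
  firstLetter : ℕ → List (List BL) → List (List BL)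
  firstLetter (suc zero) ws = map (zero ∷_) ws ++ map (suc zero ∷_) ws
  firstLetter j          ws = map (j ∷_) ws

  go : ℕ → List (List (List BL)) → List (List BL)
  go j []         = []
  go j (ws ∷ wss) = firstLetter j ws ++ go (suc j) wss

wordsOfWeightUpTo : ℕ → List (List (List BL))
wordsOfWeightUpTo zero    = [ [ [] ] ]
wordsOfWeightUpTo (suc n) = go 1 prev ∷ prev
  where prev = wordsOfWeightUpTo n

wordsOfWeight : ℕ → List (List BL)
wordsOfWeight n with wordsOfWeightUpTo n
... | []      = []
... | ws ∷ _  = ws

toXWord : List BL → Maybe (List XL)
toXWord []                  = just []
toXWord (zero ∷ w)          = maybe (λ u → just (x0 ∷ u)) nothing (toXWord w)
toXWord (suc zero ∷ w)      = maybe (λ u → just (x1 ∷ u)) nothing (toXWord w)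
toXWord (suc (suc _) ∷ _)   = nothing

toYWord : List BL → Maybe (List YL)
toYWord []          = just []
toYWord (zero ∷ _)  = nothing
toYWord (suc k ∷ w) = maybe (λ u → just (y k ∷ u)) nothing (toYWord w)

xBlock : YL → List XL
xBlock (y i) = replicate i x0 ++ [ x1 ]

-- Non-commutative formal power series over R, as coefficient functions
-- (word ↦ coefficient), and the coefficientwise (i.e. R-linear continuous)
-- extensions of the word maps in the paper.

module Series {c ℓ : Level} (R : CommutativeRing c ℓ) where
  open CommutativeRing R

  Ser : Set → Set c
  Ser A = List A → Carrier

  sumR : List Carrier → Carrier
  sumR = foldr _+_ 0#

  -- θ_X^anti : x_{ε1}⋯x_{εn} ↦ b_{εn}⋯b_{ε1}.  A B-word has a (unique)
  -- preimage iff it only uses b0, b1, namely the reversed X-word.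
  θanti : Ser XL → Ser BL
  θanti S w = maybe (λ u → S (reverse u)) 0# (toXWord w)

  Π0 : Ser BL → Ser BL
  Π0 S []          = S []
  Π0 S (zero ∷ _)  = 0#
  Π0 S (suc k ∷ w) = S (suc k ∷ w)

  -- Since τ preserves the
  -- weight, all such u lie among the finitely many words of weight (weight w).
  τ : Ser BL → Ser BL
  τ S w = sumR (map S (filter (λ u → MaybeP.≡-dec (ListP.≡-dec _≟_) (τword u) (just w))
                              (wordsOfWeight (weight w))))

  θY : Ser YL → Ser BL
  θY S w = maybe S 0# (toYWord w)

  -- Π_Y : words ending in x0 ↦ 0, x0^{k1-1}x1⋯x0^{kd-1}x1 ↦ y_{k1}⋯y_{kd}.
  ΠY : Ser XL → Ser YL
  ΠY S v = S (concat (map xBlock v))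

{-# OPTIONS --safe #-}

-- The series Π0 (θanti S) is supported on the binary words
-- b1 b0^{kd-1} ⋯ b1 b0^{k1-1} = θanti (x0^{k1-1} x1 ⋯ x0^{kd-1} x1), where its
-- coefficient is that of y_{k1} ⋯ y_{kd} in ΠY S, and τ maps this word to
-- b_{k1} ⋯ b_{kd}.  As these binary words are pairwise distinct and τ preserves
-- the weight, the sum defining each coefficient of τ (Π0 (θanti S)) has at most
-- one nonzero term, and it is the corresponding coefficient of θY (ΠY S).

module Submission where

open import Defs
open import Level using (Level)
open import Algebra.Bundles using (CommutativeRing; Monoid)
open import Data.Bool using (true; false; if_then_else_)
open import Data.Empty using (⊥-elim)
open import Data.List using (List; []; _∷_; _++_; [_]; map; reverse; replicate; concat; foldr; filter)
import Data.List.Properties as LP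
open import Data.List.Relation.Unary.All as All using (All; []; _∷_)
import Data.List.Relation.Unary.All.Properties as AllP
open import Data.Maybe using (just; nothing; maybe)
import Data.Maybe.Properties as MaybeP
open import Data.Nat using (ℕ; zero; suc; _+_)
import Data.Nat.Properties as NP
open import Data.Product using (∃; _×_; _,_)
open import Data.Sum using (_⊎_; inj₁; inj₂)
open import Function using (_∘_)
open import Relation.Nullary using (¬_; does; yes; no)
open import Relation.Nullary.Decidable using (dec-true)
open import Relation.Unary using (Pred; Decidable)
open import Relation.Binary.PropositionalEquality
  using (_≡_; _≢_; refl; sym; trans; cong; cong₂; module ≡-Reasoning)

module ListSum {c ℓ : Level} (M : Monoid c ℓ) where
  open Monoid M renaming (refl to ≈-refl; sym to ≈-sym; trans to ≈-trans)

  sum : List Carrier → Carrier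
  sum = foldr _∙_ ε

  sum-map-++ : ∀ {a} {A : Set a} (h : A → Carrier) xs ys →
               sum (map h (xs ++ ys)) ≈ sum (map h xs) ∙ sum (map h ys)
  sum-map-++ h []       ys = ≈-sym (identityˡ _)
  sum-map-++ h (x ∷ xs) ys = ≈-trans (∙-congˡ (sum-map-++ h xs ys)) (≈-sym (assoc _ _ _))

  sum-map-ε : ∀ {a} {A : Set a} (h : A → Carrier) {xs} → All (λ x → h x ≈ ε) xs →
              sum (map h xs) ≈ ε
  sum-map-ε h []            = ≈-refl
  sum-map-ε h (hx≈ε ∷ hxs≈ε) = ≈-trans (∙-cong hx≈ε (sum-map-ε h hxs≈ε)) (identityˡ ε)

  sum-map-filter : ∀ {a p} {A : Set a} {P : Pred A p} (P? : Decidable P) (h : A → Carrier) xs →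
                   sum (map h (filter P? xs)) ≈ sum (map (λ x → if does (P? x) then h x else ε) xs)
  sum-map-filter P? h []       = ≈-refl
  sum-map-filter P? h (x ∷ xs) with does (P? x)
  ... | true  = ∙-congˡ (sum-map-filter P? h xs)
  ... | false = ≈-trans (sum-map-filter P? h xs) (≈-sym (identityˡ _))

replicate-++-∷ : ∀ {a} {A : Set a} n (x : A) xs → replicate n x ++ x ∷ xs ≡ x ∷ replicate n x ++ xs
replicate-++-∷ zero    x xs = refl
replicate-++-∷ (suc n) x xs = cong (x ∷_) (replicate-++-∷ n x xs)

reverse-replicate : ∀ {a} {A : Set a} n (x : A) → reverse (replicate n x) ≡ replicate n x
reverse-replicate zero    x = refl
reverse-replicate (suc n) x = begin
  reverse (x ∷ replicate n x)      ≡⟨ LP.unfold-reverse x (replicate n x) ⟩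
  reverse (replicate n x) ++ [ x ] ≡⟨ cong (_++ [ x ]) (reverse-replicate n x) ⟩
  replicate n x ++ [ x ]           ≡⟨ replicate-++-∷ n x [] ⟩
  x ∷ replicate n x ++ []          ≡⟨ cong (x ∷_) (LP.++-identityʳ _) ⟩
  x ∷ replicate n x                ∎
  where open ≡-Reasoning

data Binary : List BL → Set where
  []   : Binary []
  b0∷_ : ∀ {u} → Binary u → Binary (0 ∷ u)
  b1∷_ : ∀ {u} → Binary u → Binary (1 ∷ u)

Binary-++ : ∀ {u v} → Binary u → Binary v → Binary (u ++ v)
Binary-++ []        bv = bv
Binary-++ (b0∷ bu) bv = b0∷ Binary-++ bu bv
Binary-++ (b1∷ bu) bv = b1∷ Binary-++ bu bv

Binary-replicate-b0 : ∀ n → Binary (replicate n 0)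
Binary-replicate-b0 zero    = []
Binary-replicate-b0 (suc n) = b0∷ Binary-replicate-b0 n

bitToX : BL → XL
bitToX zero    = x0
bitToX (suc _) = x1

toXWord-Binary : ∀ {u} → Binary u → toXWord u ≡ just (map bitToX u)
toXWord-Binary []                                 = refl
toXWord-Binary (b0∷ bu) rewrite toXWord-Binary bu = refl
toXWord-Binary (b1∷ bu) rewrite toXWord-Binary bu = refl

toXWord≡just⇒Binary : ∀ u {x} → toXWord u ≡ just x → Binary u
toXWord≡just⇒Binary []                 _ = []
toXWord≡just⇒Binary (zero ∷ u)         e with toXWord u in eq
... | just _ = b0∷ toXWord≡just⇒Binary u eq
toXWord≡just⇒Binary (suc zero ∷ u)     e with toXWord u in eq
... | just _ = b1∷ toXWord≡just⇒Binary u eq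

weight-++ : ∀ u v → weight (u ++ v) ≡ weight u + weight v
weight-++ []      v = refl
weight-++ (b ∷ u) v = trans (cong (wt b +_) (weight-++ u v)) (sym (NP.+-assoc (wt b) _ _))

weight-replicate-b0 : ∀ n → weight (replicate n 0) ≡ n
weight-replicate-b0 zero    = refl
weight-replicate-b0 (suc n) = cong suc (weight-replicate-b0 n)

-- Defs keeps the helpers of wordsOfWeightUpTo and τword private; they are
-- recovered here as the solutions of the metavariables go, step and blk.
mutual
  go : ℕ → List (List (List BL)) → List (List BL)
  go = _

  wordsOfWeight-suc≡go : ∀ n → wordsOfWeight (suc n) ≡ go 1 (wordsOfWeightUpTo n)
  wordsOfWeight-suc≡go n with 1 | wordsOfWeightUpTo n
  ... | _ | _ = refl

  step : ℕ → ℕ × List (ℕ × ℕ) → ℕ × List (ℕ × ℕ)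
  step = _

  blk : ℕ × ℕ → List BL
  blk = _

  τword≡blocks : ∀ u → τword u ≡ maybe (λ bs → just (concat (map blk (reverse bs)))) nothing (blocks u)
  τword≡blocks u = refl

  blocks-b1∷ : ∀ u → let (m , bs) = foldr step (0 , []) u in blocks (1 ∷ u) ≡ just ((0 , m) ∷ bs)
  blocks-b1∷ u = refl

wordsOfWeight-suc : ∀ n → ∃ λ L →
  wordsOfWeight (suc n) ≡ (map (0 ∷_) (wordsOfWeight n) ++ map (1 ∷_) (wordsOfWeight n)) ++ go 2 L
wordsOfWeight-suc zero    = [] , refl
wordsOfWeight-suc (suc n) = wordsOfWeightUpTo n , refl

go-nonBinary : ∀ k L → All (¬_ ∘ Binary) (go (suc (suc k)) L)
go-nonBinary k []         = []
go-nonBinary k (ws ∷ wss) = AllP.++⁺ (AllP.map⁺ (All.universal (λ _ ()) ws)) (go-nonBinary (suc k) wss)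

module WeightSum {c ℓ : Level} (M : Monoid c ℓ) where
  open Monoid M using (Carrier; _≈_; _∙_; ε; ∙-cong; identityˡ; identityʳ; setoid)
  open ListSum M
  open import Relation.Binary.Reasoning.Setoid setoid

  sum-wordsOfWeight-suc : ∀ n (h : List BL → Carrier) → (∀ u → ¬ Binary u → h u ≈ ε) →
    sum (map h (wordsOfWeight (suc n)))
      ≈ sum (map (h ∘ (0 ∷_)) (wordsOfWeight n)) ∙ sum (map (h ∘ (1 ∷_)) (wordsOfWeight n))
  sum-wordsOfWeight-suc n h h-nonBinary with wordsOfWeight-suc n
  ... | L , eq rewrite eq = begin
    sum (map h ((map (0 ∷_) W ++ map (1 ∷_) W) ++ go 2 L))
      ≈⟨ sum-map-++ h (map (0 ∷_) W ++ map (1 ∷_) W) (go 2 L) ⟩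
    sum (map h (map (0 ∷_) W ++ map (1 ∷_) W)) ∙ sum (map h (go 2 L))
      ≈⟨ ∙-cong (sum-map-++ h (map (0 ∷_) W) (map (1 ∷_) W))
                (sum-map-ε h (All.map (h-nonBinary _) (go-nonBinary 0 L))) ⟩
    (sum (map h (map (0 ∷_) W)) ∙ sum (map h (map (1 ∷_) W))) ∙ ε
      ≈⟨ identityʳ _ ⟩
    sum (map h (map (0 ∷_) W)) ∙ sum (map h (map (1 ∷_) W))
      ≡⟨ cong₂ (λ xs ys → sum xs ∙ sum ys) (sym (LP.map-∘ W)) (sym (LP.map-∘ W)) ⟩
    sum (map (h ∘ (0 ∷_)) W) ∙ sum (map (h ∘ (1 ∷_)) W) ∎
    where W = wordsOfWeight n

  off-Binary : ∀ {p} → Binary p → {h : List BL → Carrier} → (∀ u → u ≢ p → h u ≈ ε) →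
               ∀ u → ¬ Binary u → h u ≈ ε
  off-Binary bp h-point u ¬bu = h-point u (λ { refl → ¬bu bp })

  sum-wordsOfWeight-point : ∀ {p} → Binary p → (h : List BL → Carrier) → (∀ u → u ≢ p → h u ≈ ε) →
                            sum (map h (wordsOfWeight (weight p))) ≈ h p
  sum-wordsOfWeight-point [] h h-point = identityʳ _
  sum-wordsOfWeight-point {0 ∷ p} (b0∷ bp) h h-point = begin
    sum (map h (wordsOfWeight (suc (weight p))))
      ≈⟨ sum-wordsOfWeight-suc (weight p) h (off-Binary (b0∷ bp) h-point) ⟩
    sum (map (h ∘ (0 ∷_)) W) ∙ sum (map (h ∘ (1 ∷_)) W)
      ≈⟨ ∙-cong (sum-wordsOfWeight-point bp (h ∘ (0 ∷_)) (λ u u≢p → h-point (0 ∷ u) (u≢p ∘ LP.∷-injectiveʳ)))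
                (sum-map-ε (h ∘ (1 ∷_)) (All.universal (λ u → h-point (1 ∷ u) λ ()) W)) ⟩
    h (0 ∷ p) ∙ ε
      ≈⟨ identityʳ _ ⟩
    h (0 ∷ p) ∎
    where W = wordsOfWeight (weight p)
  sum-wordsOfWeight-point {1 ∷ p} (b1∷ bp) h h-point = begin
    sum (map h (wordsOfWeight (suc (weight p))))
      ≈⟨ sum-wordsOfWeight-suc (weight p) h (off-Binary (b1∷ bp) h-point) ⟩
    sum (map (h ∘ (0 ∷_)) W) ∙ sum (map (h ∘ (1 ∷_)) W)
      ≈⟨ ∙-cong (sum-map-ε (h ∘ (0 ∷_)) (All.universal (λ u → h-point (0 ∷ u) λ ()) W))
                (sum-wordsOfWeight-point bp (h ∘ (1 ∷_)) (λ u u≢p → h-point (1 ∷ u) (u≢p ∘ LP.∷-injectiveʳ))) ⟩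
    ε ∙ h (1 ∷ p)
      ≈⟨ identityˡ _ ⟩
    h (1 ∷ p) ∎
    where W = wordsOfWeight (weight p)

θYletter : YL → BL
θYletter (y i) = suc i

θYword : List YL → List BL
θYword = map θYletter

θYword-injective : ∀ {v v′} → θYword v ≡ θYword v′ → v ≡ v′
θYword-injective = LP.map-injective λ { {y i} {y j} refl → refl }

toYWord-θYword : ∀ v → toYWord (θYword v) ≡ just v
toYWord-θYword []                                = refl
toYWord-θYword (y i ∷ v) rewrite toYWord-θYword v = refl

toYWord≡just⇒θYword : ∀ w {v} → toYWord w ≡ just v → w ≡ θYword v
toYWord≡just⇒θYword []          refl = refl
toYWord≡just⇒θYword (suc i ∷ w) e with toYWord w in eq
toYWord≡just⇒θYword (suc i ∷ w) refl | just _ = cong (suc i ∷_) (toYWord≡just⇒θYword w eq)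

xWord : List YL → List XL
xWord v = concat (map xBlock v)

-- θanti (xWord (y_{k1} ⋯ y_{kd})) = b1 b0^{kd-1} ⋯ b1 b0^{k1-1}.
antiWord : List YL → List BL
antiWord []        = []
antiWord (y i ∷ v) = antiWord v ++ 1 ∷ replicate i 0

antiWord-∷ʳ : ∀ v i → antiWord (v ++ [ y i ]) ≡ (1 ∷ replicate i 0) ++ antiWord v
antiWord-∷ʳ []        i = sym (LP.++-identityʳ _)
antiWord-∷ʳ (y j ∷ v) i = trans (cong (_++ 1 ∷ replicate j 0) (antiWord-∷ʳ v i))
                                (LP.++-assoc (1 ∷ replicate i 0) (antiWord v) _)

antiWord-Binary : ∀ v → Binary (antiWord v)
antiWord-Binary []        = []
antiWord-Binary (y i ∷ v) = Binary-++ (antiWord-Binary v) (b1∷ Binary-replicate-b0 i)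

antiWord-head : ∀ v → antiWord v ≡ [] ⊎ ∃ λ u → antiWord v ≡ 1 ∷ u
antiWord-head []        = inj₁ refl
antiWord-head (y i ∷ v) with antiWord v | antiWord-head v
... | _ | inj₁ refl       = inj₂ (_ , refl)
... | _ | inj₂ (_ , refl) = inj₂ (_ , refl)

antiWord-onto : ∀ i {u} → Binary u → ∃ λ v → 1 ∷ replicate i 0 ++ u ≡ antiWord v
antiWord-onto i [] = [ y i ] , cong (1 ∷_) (LP.++-identityʳ _)
antiWord-onto i {0 ∷ u} (b0∷ bu) with antiWord-onto (suc i) bu
... | v , e = v , trans (cong (1 ∷_) (replicate-++-∷ i 0 u)) e
antiWord-onto i {1 ∷ u} (b1∷ bu) with antiWord-onto 0 bu
... | v , e = v ++ [ y i ] , trans (cong ((1 ∷ replicate i 0) ++_) e) (sym (antiWord-∷ʳ v i))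

map-bitToX-antiWord : ∀ v → map bitToX (antiWord v) ≡ reverse (xWord v)
map-bitToX-antiWord []        = refl
map-bitToX-antiWord (y i ∷ v) = begin
  map bitToX (antiWord v ++ 1 ∷ replicate i 0)
    ≡⟨ LP.map-++ bitToX (antiWord v) (1 ∷ replicate i 0) ⟩
  map bitToX (antiWord v) ++ x1 ∷ map bitToX (replicate i 0)
    ≡⟨ cong₂ (λ xs ys → xs ++ x1 ∷ ys) (map-bitToX-antiWord v) (LP.map-replicate bitToX i 0) ⟩
  reverse (xWord v) ++ x1 ∷ replicate i x0
    ≡⟨ cong (λ xs → reverse (xWord v) ++ x1 ∷ xs) (sym (reverse-replicate i x0)) ⟩
  reverse (xWord v) ++ x1 ∷ reverse (replicate i x0)
    ≡⟨ cong (reverse (xWord v) ++_) (sym (LP.reverse-++ (replicate i x0) [ x1 ])) ⟩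
  reverse (xWord v) ++ reverse (replicate i x0 ++ [ x1 ])
    ≡⟨ sym (LP.reverse-++ (replicate i x0 ++ [ x1 ]) (xWord v)) ⟩
  reverse (xWord (y i ∷ v)) ∎
  where open ≡-Reasoning

weight-antiWord : ∀ v → weight (antiWord v) ≡ weight (θYword v)
weight-antiWord []        = refl
weight-antiWord (y i ∷ v) = begin
  weight (antiWord v ++ 1 ∷ replicate i 0)
    ≡⟨ weight-++ (antiWord v) (1 ∷ replicate i 0) ⟩
  weight (antiWord v) + suc (weight (replicate i 0))
    ≡⟨ cong₂ (λ m n → m + suc n) (weight-antiWord v) (weight-replicate-b0 i) ⟩
  weight (θYword v) + suc i
    ≡⟨ NP.+-comm (weight (θYword v)) (suc i) ⟩
  suc i + weight (θYword v) ∎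
  where open ≡-Reasoning

yBlock : YL → ℕ × ℕ
yBlock (y i) = 0 , i

foldr-step-replicate-b0 : ∀ n bs → foldr step (0 , bs) (replicate n 0) ≡ (n , bs)
foldr-step-replicate-b0 zero    bs = refl
foldr-step-replicate-b0 (suc n) bs rewrite foldr-step-replicate-b0 n bs = refl

foldr-step-antiWord : ∀ v bs → foldr step (0 , bs) (antiWord v) ≡ (0 , reverse (map yBlock v) ++ bs)
foldr-step-antiWord []        bs = refl
foldr-step-antiWord (y i ∷ v) bs = begin
  foldr step (0 , bs) (antiWord v ++ 1 ∷ replicate i 0)
    ≡⟨ LP.foldr-++ step (0 , bs) (antiWord v) _ ⟩
  foldr step (step 1 (foldr step (0 , bs) (replicate i 0))) (antiWord v)
    ≡⟨ cong (λ s → foldr step (step 1 s) (antiWord v)) (foldr-step-replicate-b0 i bs) ⟩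
  foldr step (0 , (0 , i) ∷ bs) (antiWord v)
    ≡⟨ foldr-step-antiWord v ((0 , i) ∷ bs) ⟩
  0 , reverse (map yBlock v) ++ (0 , i) ∷ bs
    ≡⟨ cong (0 ,_) (sym (LP.++-assoc (reverse (map yBlock v)) [ 0 , i ] bs)) ⟩
  0 , (reverse (map yBlock v) ++ [ 0 , i ]) ++ bs
    ≡⟨ cong (λ xs → 0 , xs ++ bs) (sym (LP.unfold-reverse (0 , i) (map yBlock v))) ⟩
  0 , reverse (map yBlock (y i ∷ v)) ++ bs ∎
  where open ≡-Reasoning

concat-map-blk-yBlock : ∀ v → concat (map blk (map yBlock v)) ≡ θYword v
concat-map-blk-yBlock []        = refl
concat-map-blk-yBlock (y i ∷ v) = cong (suc i ∷_) (concat-map-blk-yBlock v)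

τword-antiWord : ∀ v → τword (antiWord v) ≡ just (θYword v)
τword-antiWord v rewrite foldr-step-antiWord v []
                       | LP.++-identityʳ (reverse (map yBlock v))
                       | LP.reverse-involutive (map yBlock v)
                       = cong just (concat-map-blk-yBlock v)

τword-preimage? : (w : List BL) → Decidable (λ u → τword u ≡ just w)
τword-preimage? w u = MaybeP.≡-dec (LP.≡-dec NP._≟_) (τword u) (just w)

module Coefficient {c ℓ : Level} (R : CommutativeRing c ℓ) where
  open CommutativeRing R using (Carrier; _≈_; 0#; +-monoid; setoid; reflexive)
    renaming (refl to ≈-refl; trans to ≈-trans)
  open Series R
  open ListSum +-monoid
  open WeightSum +-monoid

  Π0-antiWord : ∀ (T : Ser BL) v → Π0 T (antiWord v) ≡ T (antiWord v)
  Π0-antiWord T v with antiWord v | antiWord-head v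
  ... | _ | inj₁ refl       = refl
  ... | _ | inj₂ (_ , refl) = refl

  module _ (S : Ser XL) where

    Π0θanti-antiWord : ∀ v → Π0 (θanti S) (antiWord v) ≡ ΠY S v
    Π0θanti-antiWord v rewrite Π0-antiWord (θanti S) v
                             | toXWord-Binary (antiWord-Binary v)
                             | map-bitToX-antiWord v
                             = cong S (LP.reverse-involutive (xWord v))

    Π0θanti-support : ∀ u → Π0 (θanti S) u ≡ 0# ⊎ ∃ λ v → u ≡ antiWord v
    Π0θanti-support []                = inj₂ ([] , refl)
    Π0θanti-support (zero ∷ u)        = inj₁ refl
    Π0θanti-support (suc (suc _) ∷ u) = inj₁ refl
    Π0θanti-support (suc zero ∷ u) with toXWord u in eq
    ... | nothing = inj₁ refl
    ... | just _  = inj₂ (antiWord-onto 0 (toXWord≡just⇒Binary u eq))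

    τ-summand : List BL → List BL → Carrier
    τ-summand w u = if does (τword-preimage? w u) then Π0 (θanti S) u else 0#

    τ-summand-support : ∀ w u → τ-summand w u ≈ 0# ⊎ ∃ λ v → u ≡ antiWord v × w ≡ θYword v
    τ-summand-support w u with Π0θanti-support u | τword-preimage? w u
    ... | inj₁ f≡0        | yes _ = inj₁ (reflexive f≡0)
    ... | inj₁ _          | no _  = inj₁ ≈-refl
    ... | inj₂ (v , refl) | yes e = inj₂ (v , refl , MaybeP.just-injective (trans (sym e) (τword-antiWord v)))
    ... | inj₂ _          | no _  = inj₁ ≈-refl

    sum-τ-summand : ∀ w → sum (map (τ-summand w) (wordsOfWeight (weight w))) ≈ θY (ΠY S) w
    sum-τ-summand w with toYWord w in eq
    ... | nothing = sum-map-ε (τ-summand w) (All.universal vanishes (wordsOfWeight (weight w)))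
      where
      vanishes : ∀ u → τ-summand w u ≈ 0#
      vanishes u with τ-summand-support w u
      ... | inj₁ ≈0 = ≈0
      ... | inj₂ (v , _ , refl) with () ← trans (sym eq) (toYWord-θYword v)
    ... | just v₀ with refl ← toYWord≡just⇒θYword w eq = begin
      sum (map (τ-summand w) (wordsOfWeight (weight (θYword v₀))))
        ≡⟨ cong (λ n → sum (map (τ-summand w) (wordsOfWeight n))) (sym (weight-antiWord v₀)) ⟩
      sum (map (τ-summand w) (wordsOfWeight (weight (antiWord v₀))))
        ≈⟨ sum-wordsOfWeight-point (antiWord-Binary v₀) (τ-summand w) vanishes-off ⟩
      τ-summand w (antiWord v₀)
        ≡⟨ cong (λ b → if b then Π0 (θanti S) (antiWord v₀) else 0#)
                (dec-true (τword-preimage? w (antiWord v₀)) (τword-antiWord v₀)) ⟩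
      Π0 (θanti S) (antiWord v₀)
        ≡⟨ Π0θanti-antiWord v₀ ⟩
      ΠY S v₀ ∎
      where
      open import Relation.Binary.Reasoning.Setoid setoid
      vanishes-off : ∀ u → u ≢ antiWord v₀ → τ-summand w u ≈ 0#
      vanishes-off u u≢ with τ-summand-support w u
      ... | inj₁ ≈0               = ≈0
      ... | inj₂ (v , refl , w≡v) = ⊥-elim (u≢ (cong antiWord (θYword-injective (sym w≡v))))

    coefficient : ∀ w → τ (Π0 (θanti S)) w ≈ θY (ΠY S) w
    coefficient w = ≈-trans (sum-map-filter (τword-preimage? w) (Π0 (θanti S)) (wordsOfWeight (weight w)))
                            (sum-τ-summand w)

lemma7p1 : {c ℓ : Level} (R : CommutativeRing c ℓ) → QAlgebra R →
    let open CommutativeRing R using (_≈_)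
        open Series R
    in (S : Ser XL) (w : List BL) → τ (Π0 (θanti S)) w ≈ θY (ΠY S) w
lemma7p1 R _ = Coefficient.coefficient R
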